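{- Let $k\geq 2$ and let $M=(\mu_1,\dots,\mu_k)$ be a sorting plan of order $k$. Then for every $i\in\{2,\dots,k\}$, the operation sequence $\mu_i$ contains at most $2$ consecutive letters $\mathtt{d}$; equivalently, every block of $\alpha_i$ with respect to $\mu_i$ has size at most $3$, where $(\alpha_1,\dots,\alpha_{k+1})$ is the semitrace of $M$.
   Context: An operation sequence of length $n+1$ is a word $c_1\dots c_{n+1}$ over $\{\mathtt{a},\mathtt{d}\}$ with $c_1=c_{n+1}=\mathtt{a}$. For a permutation $\pi$ of $[n]$ and operation sequence $\mu$ with $\mathtt{a}$'s at indices $i_1<\dots<i_t$, the blocks of $\pi$ w.r.t. $\mu$ are the contiguous factors at positions $i_j,\dots,i_{j+1}-1$, and $\mathrm{rev}(\pi,\mu)$ reverses each block. $w(\pi)=c_1\dots c_{n+1}$ with $c_1=c_{n+1}=\mathtt{a}$ and, for $2\le m\le n$, $c_m=\mathtt{a}$ if $\pi(m-1)<\pi(m)$, else $\mathtt{d}$. An operation array of length $n+1$ and order $k$ is a $k$-tuple $M=(\mu_1,\dots,\mu_k)$ of operation sequences of length $n+1$; its semitrace is $(\alpha_1,\dots,\alpha_{k+1})$ with $\alpha_{k+1}$ the identity of $[n]$ and $\alpha_i=\mathrm{rev}(\alpha_{i+1},\mu_i)$ for $i=k,\dots,1$. $M$ is a sorting plan if $w(\alpha_i)=\mu_i$ for all $i\in[k]$. -}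

module Defs where

open import Data.Nat using (ℕ; zero; suc; _<ᵇ_; _<_; _+_)
open import Data.Nat.Properties using (+-identityʳ; +-suc; +-comm)
open import Data.Fin using (Fin; toℕ; inject₁; fromℕ<)
open import Data.Bool using (Bool; true; false)
open import Data.Vec using (Vec; []; _∷_; _++_; head; last; init; lookup; allFin; cast)
open import Data.Product using (Σ; _×_; _,_; ∃)
open import Relation.Binary.PropositionalEquality using (_≡_; sym)

data Op : Set where
  𝕒 𝕕 : Op

record OpSeq (n : ℕ) : Set where
  constructor opseq
  field
    word    : Vec Op (suc n)
    first-a : head word ≡ 𝕒
    last-a  : last word ≡ 𝕒
open OpSeq public

-- Permutations of [n] in one-line notation π(1) … π(n), values in Fin n
-- (value j stands for j+1).  All permutations occurring below are obtained
-- from the identity by block reversals, hence are genuine permutations.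
Perm : ℕ → Set
Perm n = Vec (Fin n) n

identity : (n : ℕ) → Perm n
identity n = allFin n

-- revV cur π cs : cur is the current (already reversed) block; cs are the
-- letters at the positions of π.  A new block starts at every position
-- carrying the letter a.
revV : {A : Set} {j m : ℕ} → Vec A j → Vec A m → Vec Op m → Vec A (j + m)
revV {j = j} cur [] [] = cast (sym (+-identityʳ j)) cur
revV {j = j} {suc m} cur (x ∷ xs) (𝕒 ∷ cs) = cur ++ revV (x ∷ []) xs cs
revV {j = j} {suc m} cur (x ∷ xs) (𝕕 ∷ cs) = cast (sym (+-suc j m)) (revV (x ∷ cur) xs cs)

-- rev(π, μ): reverse every block of π w.r.t. μ; blocks start at the
-- indices i ≤ n with c_i = a (c_1 = a, so the first block starts at 1).
rev : {n : ℕ} → Perm n → OpSeq n → Perm n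
rev π μ = revV [] π (init (word μ))

ascLetter : {n : ℕ} → Fin n → Fin n → Op
ascLetter x y with toℕ x <ᵇ toℕ y
... | true  = 𝕒
... | false = 𝕕

innerLetters : {n m : ℕ} → Fin n → Vec (Fin n) m → Vec Op m
innerLetters x []       = []
innerLetters x (y ∷ ys) = ascLetter x y ∷ innerLetters y ys

wWord : {n : ℕ} → Perm n → Vec Op (suc n)
wWord {zero}  []       = 𝕒 ∷ []
wWord {suc n} (x ∷ xs) = 𝕒 ∷ cast (+-comm n 1) (innerLetters x xs ++ (𝕒 ∷ []))

OpArray : ℕ → ℕ → Set
OpArray n k = Vec (OpSeq n) k

semitrace : {n k : ℕ} → OpArray n k → Vec (Perm n) (suc k)
semitrace {n} []      = identity n ∷ []
semitrace {n} (μ ∷ M) with semitrace M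
... | α ∷ αs = rev α μ ∷ α ∷ αs

IsSortingPlan : {n k : ℕ} → OpArray n k → Set
IsSortingPlan {n} {k} M =
  (i : Fin k) → wWord (lookup (semitrace M) (inject₁ i)) ≡ word (lookup M i)

AtMostTwoConsecutiveD : {m : ℕ} → Vec Op m → Set
AtMostTwoConsecutiveD {m} c =
  (j : ℕ) (p : suc (suc j) < m) →
  lookup c (fromℕ< p) ≡ 𝕕 →
  lookup c (fromℕ< {suc j} (Data.Nat.Properties.<-trans (Data.Nat.Properties.n<1+n (suc j)) p)) ≡ 𝕕 →
  lookup c (fromℕ< {j} (Data.Nat.Properties.<-trans (Data.Nat.Properties.n<1+n j)
                          (Data.Nat.Properties.<-trans (Data.Nat.Properties.n<1+n (suc j)) p))) ≡ 𝕕 →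
  Data.Empty.⊥
  where import Data.Nat.Properties
        import Data.Empty

-- Write α = α_i and c = μ_{i-1}, so that w(rev(α, c)) = c.  Reading this identity block by
-- block shows that every block of α w.r.t. c is weakly increasing (inside a block c has letter d,
-- so the reversed block descends), and that at each block boundary the first entry of the earlier
-- block of α is smaller than the last entry of the next one, these two being adjacent in
-- rev(α, c).  Three consecutive letters d in μ_i = w(α) give four consecutive entries
-- h > x > y > z of α.  Then x, y and z each start a block, so x and y are singleton blocks, and
-- the boundary condition between them asks for x < y.
module Submission where

open import Defs
open import Data.Nat using (ℕ; _≤_)
open import Data.Fin using (Fin; toℕ)
open import Data.Vec using (lookup)

open import Data.Nat using (zero; suc; _<ᵇ_; s≤s; s<s⁻¹)
open import Data.Nat.Properties using (<ᵇ-reflects-<; suc-injective; <⇒≱; <⇒≤; ≮⇒≥)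
open import Data.Fin as Fin using (_<_; inject₁)
import Data.Fin.Properties as Fin
import Data.Vec as Vec
open import Data.Vec.Properties using (toList-cast; toList-++; toList-∷ʳ; length-toList)
open import Data.List using (List; []; _∷_; _++_; [_]; replicate; length; tabulate; allFin)
open import Data.List.Properties
  using (∷-injectiveˡ; ∷-injectiveʳ; ++-identityʳ; ++-cancelʳ; ++-conicalʳ; length-replicate)
open import Data.List.Relation.Unary.All using (_∷_)
open import Data.List.Relation.Unary.AllPairs using (_∷_)
open import Data.List.Relation.Unary.Unique.Propositional using (Unique)
open import Data.List.Relation.Unary.Unique.Propositional.Properties using (allFin⁺)
open import Data.List.Relation.Binary.Permutation.Propositional
  using (_↭_; ↭⇒↭ₛ; ↭-refl; ↭-reflexive; ↭-trans; ↭-sym)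
open import Data.List.Relation.Binary.Permutation.Propositional.Properties using (++⁺ˡ; shift)
open import Data.List.Relation.Binary.Permutation.Setoid.Properties using (Unique-resp-↭)
open import Data.Bool using (true; false)
open import Data.Empty using (⊥)
open import Data.Product using (Σ; _×_; _,_; proj₁; proj₂; map₂)
open import Function using (_∘_)
open import Relation.Nullary using (¬_)
open import Relation.Nullary.Reflects using (ofʸ; ofⁿ)
open import Relation.Binary.PropositionalEquality hiding ([_])

private
  variable
    A : Set
    n m : ℕ
    ℓ : Op
    cs qs : List Op
    p b h x y z : Fin n
    bs xs rest : List (Fin n)

ascLetter-𝕒⇒< : (x y : Fin n) → ascLetter x y ≡ 𝕒 → x < y
ascLetter-𝕒⇒< x y e with toℕ x <ᵇ toℕ y | <ᵇ-reflects-< (toℕ x) (toℕ y)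
... | true  | ofʸ x<y = x<y
ascLetter-𝕒⇒< x y () | false | _

ascLetter-𝕕⇒≥ : (x y : Fin n) → ascLetter x y ≡ 𝕕 → y Fin.≤ x
ascLetter-𝕕⇒≥ x y e with toℕ x <ᵇ toℕ y | <ᵇ-reflects-< (toℕ x) (toℕ y)
ascLetter-𝕕⇒≥ x y () | true | _
... | false | ofⁿ x≮y = ≮⇒≥ x≮y

ascLetter-𝕕⇒> : (x y : Fin n) → ascLetter x y ≡ 𝕕 → x ≢ y → y < x
ascLetter-𝕕⇒> x y e x≢y = Fin.≤∧≢⇒< (ascLetter-𝕕⇒≥ x y e) (x≢y ∘ sym)

ascentsFrom : Fin n → List (Fin n) → List Op
ascentsFrom x []       = []
ascentsFrom x (y ∷ ys) = ascLetter x y ∷ ascentsFrom y ys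

ascentWord : List (Fin n) → List Op
ascentWord []       = []
ascentWord (x ∷ xs) = 𝕒 ∷ ascentsFrom x xs

-- As in revV, the first argument is the current block, already reversed.
revBlocks : List A → List A → List Op → List A
revBlocks block []       _         = block
revBlocks block (x ∷ xs) []        = block ++ x ∷ xs
revBlocks block (x ∷ xs) (𝕒 ∷ cs) = block ++ revBlocks [ x ] xs cs
revBlocks block (x ∷ xs) (𝕕 ∷ cs) = revBlocks (x ∷ block) xs cs

lastOr : A → List A → A
lastOr x []       = x
lastOr x (y ∷ ys) = lastOr y ys

length-ascentsFrom : (x : Fin n) (ys : List (Fin n)) → length (ascentsFrom x ys) ≡ length ys
length-ascentsFrom x []       = refl
length-ascentsFrom x (y ∷ ys) = cong suc (length-ascentsFrom y ys)

ascentsFrom-++ : (x : Fin n) (ys zs : List (Fin n)) →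
                 ascentsFrom x (ys ++ zs) ≡ ascentsFrom x ys ++ ascentsFrom (lastOr x ys) zs
ascentsFrom-++ x []       zs = refl
ascentsFrom-++ x (y ∷ ys) zs = cong (ascLetter x y ∷_) (ascentsFrom-++ y ys zs)

++-injective : (xs ys : List A) {us vs : List A} → length xs ≡ length ys →
               xs ++ us ≡ ys ++ vs → xs ≡ ys × us ≡ vs
++-injective []       []       _  e = refl , e
++-injective (x ∷ xs) (y ∷ ys) le e with ++-injective xs ys (suc-injective le) (∷-injectiveʳ e)
... | xs≡ys , us≡vs = cong₂ _∷_ (∷-injectiveˡ e) xs≡ys , us≡vs

replicate-++-∷ : ∀ k (x : A) ys → replicate k x ++ x ∷ ys ≡ x ∷ replicate k x ++ ys
replicate-++-∷ zero    x ys = refl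
replicate-++-∷ (suc k) x ys = cong (x ∷_) (replicate-++-∷ k x ys)

-- b ∷ bs is the current block of π read backwards, p the entry of rev(π, c) just before it, and
-- ℓ the letter at the start of the block.
record BlockScan (ℓ : Op) (p b : Fin n) (bs xs : List (Fin n)) (cs : List Op) : Set where
  constructor scanned
  field
    letters : ascentsFrom p (revBlocks (b ∷ bs) xs cs) ≡ ℓ ∷ replicate (length bs) 𝕕 ++ cs

scan-𝕕 : BlockScan ℓ p b bs (x ∷ xs) (𝕕 ∷ cs) → BlockScan ℓ p x (b ∷ bs) xs cs
scan-𝕕 {ℓ = ℓ} {bs = bs} {cs = cs} (scanned e) =
  scanned (trans e (cong (ℓ ∷_) (replicate-++-∷ (length bs) 𝕕 cs)))

scan-𝕒 : BlockScan ℓ p b bs (x ∷ xs) (𝕒 ∷ cs) →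
         ascentsFrom p (b ∷ bs) ≡ ℓ ∷ replicate (length bs) 𝕕 × BlockScan 𝕒 (lastOr b bs) x [] xs cs
scan-𝕒 {ℓ = ℓ} {p = p} {b = b} {bs = bs} {x = x} {xs = xs} {cs = cs} (scanned e) = map₂ scanned
  (++-injective (ascentsFrom p (b ∷ bs)) (ℓ ∷ replicate (length bs) 𝕕) same-length
    (trans (sym (ascentsFrom-++ p (b ∷ bs) (revBlocks [ x ] xs cs))) e))
  where
  same-length : length (ascentsFrom p (b ∷ bs)) ≡ suc (length (replicate (length bs) 𝕕))
  same-length = trans (length-ascentsFrom p (b ∷ bs)) (cong suc (sym (length-replicate (length bs))))

scan-block : (bs xs : List (Fin n)) (cs : List Op) → length xs ≡ length cs →
             BlockScan ℓ p b bs xs cs → ascentsFrom b bs ≡ replicate (length bs) 𝕕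
scan-block bs []       []       _  (scanned e) = ∷-injectiveʳ (trans e (++-identityʳ _))
scan-block bs (x ∷ xs) (𝕒 ∷ cs) _  scan = ∷-injectiveʳ (proj₁ (scan-𝕒 scan))
scan-block bs (x ∷ xs) (𝕕 ∷ cs) le scan =
  ∷-injectiveʳ (scan-block (_ ∷ bs) xs cs (suc-injective le) (scan-𝕕 scan))

scan-𝕕⇒≤ : length xs ≡ length cs → BlockScan ℓ p b bs (x ∷ xs) (𝕕 ∷ cs) → b Fin.≤ x
scan-𝕕⇒≤ le scan = ascLetter-𝕕⇒≥ _ _ (∷-injectiveˡ (scan-block _ _ _ le (scan-𝕕 scan)))

data HasDescent₄ {n : ℕ} : List (Fin n) → Set where
  here  : x < h → y < x → z < y → HasDescent₄ (h ∷ x ∷ y ∷ z ∷ rest)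
  there : HasDescent₄ xs → HasDescent₄ (x ∷ xs)

scan-descent₃ : {x y : Fin n} (cs : List Op) →
                length (y ∷ z ∷ rest) ≡ length cs → BlockScan ℓ p x [] (y ∷ z ∷ rest) cs →
                y < x → z < y → ⊥
scan-descent₃ (𝕕 ∷ cs) le scan y<x _ = <⇒≱ y<x (scan-𝕕⇒≤ (suc-injective le) scan)
scan-descent₃ (𝕒 ∷ 𝕕 ∷ cs) le scan _ z<y =
  <⇒≱ z<y (scan-𝕕⇒≤ (suc-injective (suc-injective le)) (proj₂ (scan-𝕒 scan)))
scan-descent₃ {x = x} {y = y} (𝕒 ∷ 𝕒 ∷ cs) le scan y<x _ =
  <⇒≱ y<x (<⇒≤ (ascLetter-𝕒⇒< x y (∷-injectiveˡ (proj₁ (scan-𝕒 (proj₂ (scan-𝕒 scan)))))))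

scan-descent₄-here : (cs : List Op) →
                     length (x ∷ y ∷ z ∷ rest) ≡ length cs → BlockScan ℓ p h bs (x ∷ y ∷ z ∷ rest) cs →
                     x < h → y < x → z < y → ⊥
scan-descent₄-here (𝕕 ∷ cs) le scan x<h _ _ = <⇒≱ x<h (scan-𝕕⇒≤ (suc-injective le) scan)
scan-descent₄-here (𝕒 ∷ cs) le scan _ y<x z<y =
  scan-descent₃ cs (suc-injective le) (proj₂ (scan-𝕒 scan)) y<x z<y

scan-descent₄ : (xs : List (Fin n)) (cs : List Op) →
                length xs ≡ length cs → BlockScan ℓ p b bs xs cs → ¬ HasDescent₄ (b ∷ xs)
scan-descent₄ _        cs       le scan (here x<h y<x z<y) = scan-descent₄-here cs le scan x<h y<x z<y
scan-descent₄ (x ∷ xs) (𝕒 ∷ cs) le scan (there d) =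
  scan-descent₄ xs cs (suc-injective le) (proj₂ (scan-𝕒 scan)) d
scan-descent₄ (x ∷ xs) (𝕕 ∷ cs) le scan (there d) = scan-descent₄ xs cs (suc-injective le) (scan-𝕕 scan) d

ascentWord-ascentsFrom : (p : Fin n) (ys : List (Fin n)) →
                         ℓ ∷ cs ≡ ascentWord ys → Σ Op λ ℓ′ → ascentsFrom p ys ≡ ℓ′ ∷ cs
ascentWord-ascentsFrom p (y ∷ ys) e = ascLetter p y , cong (ascLetter p y ∷_) (sym (∷-injectiveʳ e))

consistent⇒no-descent₄ : (xs : List (Fin n)) (cs : List Op) → length xs ≡ length cs →
                          cs ≡ ascentWord (revBlocks [] xs cs) → ¬ HasDescent₄ xs
consistent⇒no-descent₄ (x ∷ xs) (c ∷ cs) le e =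
  scan-descent₄ xs cs (suc-injective le)
    -- x stands in for the missing predecessor of the first block; that letter is never inspected.
    (scanned (proj₂ (ascentWord-ascentsFrom x _ (trans e (cong ascentWord (first-block c))))))
  where
  first-block : ∀ c → revBlocks [] (x ∷ xs) (c ∷ cs) ≡ revBlocks [ x ] xs cs
  first-block 𝕒 = refl
  first-block 𝕕 = refl

ascentsFrom-𝕕𝕕𝕕⇒descent₄ : (h : Fin n) (xs : List (Fin n)) (ps : List Op) →
                            Unique (h ∷ xs) → ascentsFrom h xs ++ [ 𝕒 ] ≡ ps ++ 𝕕 ∷ 𝕕 ∷ 𝕕 ∷ qs →
                            HasDescent₄ (h ∷ xs)
ascentsFrom-𝕕𝕕𝕕⇒descent₄ h (x ∷ y ∷ z ∷ rest) [] ((h≢x ∷ _) ∷ (x≢y ∷ _) ∷ (y≢z ∷ _) ∷ _) e =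
  here (ascLetter-𝕕⇒> h x (∷-injectiveˡ e) h≢x)
       (ascLetter-𝕕⇒> x y (∷-injectiveˡ (∷-injectiveʳ e)) x≢y)
       (ascLetter-𝕕⇒> y z (∷-injectiveˡ (∷-injectiveʳ (∷-injectiveʳ e))) y≢z)
ascentsFrom-𝕕𝕕𝕕⇒descent₄ h []           [] _ ()
ascentsFrom-𝕕𝕕𝕕⇒descent₄ h (x ∷ [])     [] _ e with () ← ∷-injectiveʳ e
ascentsFrom-𝕕𝕕𝕕⇒descent₄ h (x ∷ y ∷ []) [] _ e with () ← ∷-injectiveʳ (∷-injectiveʳ e)
ascentsFrom-𝕕𝕕𝕕⇒descent₄ h [] (_ ∷ ps) _ e with () ← ++-conicalʳ ps _ (sym (∷-injectiveʳ e))
ascentsFrom-𝕕𝕕𝕕⇒descent₄ h (x ∷ xs) (_ ∷ ps) (_ ∷ unique) e =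
  there (ascentsFrom-𝕕𝕕𝕕⇒descent₄ x xs ps unique (∷-injectiveʳ e))

toList-revV : ∀ {j m} (block : Vec.Vec A j) (xs : Vec.Vec A m) (cs : Vec.Vec Op m) →
              Vec.toList (revV block xs cs) ≡ revBlocks (Vec.toList block) (Vec.toList xs) (Vec.toList cs)
toList-revV block Vec.[]       Vec.[]         = toList-cast _ block
toList-revV block (x Vec.∷ xs) (𝕒 Vec.∷ cs) =
  trans (toList-++ block (revV (x Vec.∷ Vec.[]) xs cs))
        (cong (Vec.toList block ++_) (toList-revV (x Vec.∷ Vec.[]) xs cs))
toList-revV block (x Vec.∷ xs) (𝕕 Vec.∷ cs) = trans (toList-cast _ _) (toList-revV (x Vec.∷ block) xs cs)

toList-innerLetters : (x : Fin n) (xs : Vec.Vec (Fin n) m) →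
                      Vec.toList (innerLetters x xs) ≡ ascentsFrom x (Vec.toList xs)
toList-innerLetters x Vec.[]       = refl
toList-innerLetters x (y Vec.∷ xs) = cong (ascLetter x y ∷_) (toList-innerLetters y xs)

toList-wWord : (π : Perm n) → Vec.toList (wWord π) ≡ ascentWord (Vec.toList π) ++ [ 𝕒 ]
toList-wWord Vec.[]       = refl
toList-wWord (x Vec.∷ xs) = cong (𝕒 ∷_) (begin
  Vec.toList (Vec.cast _ (innerLetters x xs Vec.++ 𝕒 Vec.∷ Vec.[])) ≡⟨ toList-cast _ _ ⟩
  Vec.toList (innerLetters x xs Vec.++ 𝕒 Vec.∷ Vec.[])              ≡⟨ toList-++ (innerLetters x xs) _ ⟩
  Vec.toList (innerLetters x xs) ++ [ 𝕒 ]
    ≡⟨ cong (_++ [ 𝕒 ]) (toList-innerLetters x xs) ⟩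
  ascentsFrom x (Vec.toList xs) ++ [ 𝕒 ]                            ∎)
  where open ≡-Reasoning

toList-init-last : (v : Vec.Vec A (suc m)) → Vec.toList v ≡ Vec.toList (Vec.init v) ++ [ Vec.last v ]
toList-init-last v with Vec.initLast v
... | ys , y , refl = toList-∷ʳ y ys

toList-tabulate : (f : Fin n → A) → Vec.toList (Vec.tabulate f) ≡ tabulate f
toList-tabulate {n = zero}  f = refl
toList-tabulate {n = suc n} f = cong (f Fin.zero ∷_) (toList-tabulate (f ∘ Fin.suc))

revBlocks-↭ : (block xs : List A) (cs : List Op) → revBlocks block xs cs ↭ block ++ xs
revBlocks-↭ block []       cs       = ↭-reflexive (sym (++-identityʳ block))
revBlocks-↭ block (x ∷ xs) []       = ↭-refl
revBlocks-↭ block (x ∷ xs) (𝕒 ∷ cs) = ++⁺ˡ block (revBlocks-↭ [ x ] xs cs)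
revBlocks-↭ block (x ∷ xs) (𝕕 ∷ cs) = ↭-trans (revBlocks-↭ (x ∷ block) xs cs) (↭-sym (shift x block xs))

rev-↭ : (π : Perm n) (μ : OpSeq n) → Vec.toList (rev π μ) ↭ Vec.toList π
rev-↭ π μ = ↭-trans (↭-reflexive (toList-revV Vec.[] π _)) (revBlocks-↭ [] (Vec.toList π) _)

rev-fixpoint⇒no-descent₄ : (π : Perm n) (μ : OpSeq n) → wWord (rev π μ) ≡ word μ →
                           ¬ HasDescent₄ (Vec.toList π)
rev-fixpoint⇒no-descent₄ π μ fixpoint =
  consistent⇒no-descent₄ (Vec.toList π) letters
    (trans (length-toList π) (sym (length-toList (Vec.init (word μ)))))
    (++-cancelʳ [ 𝕒 ] letters _ consistent)
  where
  open ≡-Reasoning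
  letters = Vec.toList (Vec.init (word μ))
  consistent : letters ++ [ 𝕒 ] ≡ ascentWord (revBlocks [] (Vec.toList π) letters) ++ [ 𝕒 ]
  consistent = begin
    letters ++ [ 𝕒 ]                   ≡⟨ cong (λ c → letters ++ [ c ]) (last-a μ) ⟨
    letters ++ [ Vec.last (word μ) ]   ≡⟨ toList-init-last (word μ) ⟨
    Vec.toList (word μ)                ≡⟨ cong Vec.toList fixpoint ⟨
    Vec.toList (wWord (rev π μ))       ≡⟨ toList-wWord (rev π μ) ⟩
    ascentWord (Vec.toList (rev π μ)) ++ [ 𝕒 ]
      ≡⟨ cong (λ β → ascentWord β ++ [ 𝕒 ]) (toList-revV Vec.[] π _) ⟩
    ascentWord (revBlocks [] (Vec.toList π) letters) ++ [ 𝕒 ] ∎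

wWord-𝕕𝕕𝕕⇒descent₄ : (π : Perm n) {ps : List Op} → Unique (Vec.toList π) →
                      Vec.toList (wWord π) ≡ ps ++ 𝕕 ∷ 𝕕 ∷ 𝕕 ∷ qs → HasDescent₄ (Vec.toList π)
wWord-𝕕𝕕𝕕⇒descent₄ (x Vec.∷ xs) {_ ∷ ps} unique e =
  ascentsFrom-𝕕𝕕𝕕⇒descent₄ x (Vec.toList xs) ps unique
    (∷-injectiveʳ (trans (sym (toList-wWord (x Vec.∷ xs))) e))
wWord-𝕕𝕕𝕕⇒descent₄ Vec.[] {_ ∷ ps} _ e with () ← ++-conicalʳ ps _ (sym (∷-injectiveʳ e))

semitrace-cons : {k : ℕ} (μ : OpSeq n) (M : OpArray n k) →
                 semitrace (μ Vec.∷ M) ≡ rev (lookup (semitrace M) Fin.zero) μ Vec.∷ semitrace M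
semitrace-cons μ M with semitrace M
... | α Vec.∷ αs = refl

semitrace-step : {k : ℕ} (M : OpArray n k) (i : Fin k) →
                 lookup (semitrace M) (inject₁ i) ≡ rev (lookup (semitrace M) (Fin.suc i)) (lookup M i)
semitrace-step (μ Vec.∷ M) i rewrite semitrace-cons μ M with i
... | Fin.zero  = refl
... | Fin.suc i = semitrace-step M i

semitrace-↭ : {k : ℕ} (M : OpArray n k) (i : Fin (suc k)) →
              Vec.toList (lookup (semitrace M) i) ↭ allFin n
semitrace-↭ Vec.[] Fin.zero = ↭-reflexive (toList-tabulate (λ i → i))
semitrace-↭ (μ Vec.∷ M) i rewrite semitrace-cons μ M with i
... | Fin.zero  = ↭-trans (rev-↭ _ μ) (semitrace-↭ M Fin.zero)
... | Fin.suc i = semitrace-↭ M i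

semitrace-unique : {k : ℕ} (M : OpArray n k) (i : Fin (suc k)) →
                   Unique (Vec.toList (lookup (semitrace M) i))
semitrace-unique {n} M i = Unique-resp-↭ (setoid (Fin n)) (↭⇒↭ₛ (↭-sym (semitrace-↭ M i))) (allFin⁺ n)

no-𝕕𝕕𝕕-infix⇒atMostTwoConsecutiveD : (v : Vec.Vec Op m) →
                                     (∀ ps qs → Vec.toList v ≢ ps ++ 𝕕 ∷ 𝕕 ∷ 𝕕 ∷ qs) →
                                     AtMostTwoConsecutiveD v
no-𝕕𝕕𝕕-infix⇒atMostTwoConsecutiveD (𝕕 Vec.∷ 𝕕 Vec.∷ 𝕕 Vec.∷ v) no-infix zero _ refl refl refl =
  no-infix [] (Vec.toList v) refl
no-𝕕𝕕𝕕-infix⇒atMostTwoConsecutiveD (_ Vec.∷ Vec.[])          _ zero (s≤s ())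
no-𝕕𝕕𝕕-infix⇒atMostTwoConsecutiveD (_ Vec.∷ _ Vec.∷ Vec.[]) _ zero (s≤s (s≤s ()))
no-𝕕𝕕𝕕-infix⇒atMostTwoConsecutiveD (x Vec.∷ v) no-infix (suc j) p =
  no-𝕕𝕕𝕕-infix⇒atMostTwoConsecutiveD v (λ ps qs e → no-infix (x ∷ ps) qs (cong (x ∷_) e)) j (s<s⁻¹ p)

lemma1 : (n k : ℕ) → 2 ≤ k → (M : OpArray n k) → IsSortingPlan M →
         (i : Fin k) → 1 ≤ toℕ i → AtMostTwoConsecutiveD (word (lookup M i))
lemma1 n k       _ M plan Fin.zero    ()
lemma1 n (suc k) _ M plan (Fin.suc i) _ =
  no-𝕕𝕕𝕕-infix⇒atMostTwoConsecutiveD (word (lookup M (Fin.suc i))) λ ps qs 𝕕𝕕𝕕 →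
    rev-fixpoint⇒no-descent₄ α μ fixpoint
      (wWord-𝕕𝕕𝕕⇒descent₄ α (semitrace-unique M (Fin.suc (inject₁ i)))
        (trans (cong Vec.toList (plan (Fin.suc i))) 𝕕𝕕𝕕))
  where
  α = lookup (semitrace M) (Fin.suc (inject₁ i))
  μ = lookup M (inject₁ i)
  fixpoint : wWord (rev α μ) ≡ word μ
  fixpoint = subst (λ β → wWord β ≡ word μ) (semitrace-step M (inject₁ i)) (plan (inject₁ i))
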